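{- Let $m, n, d$ be positive integers. Then $R_{2m}(n) = d$ if and only if $\mathsf{s}_{2m}(\mathbb{Z}_2^{d-1}) \leq n < \mathsf{s}_{2m}(\mathbb{Z}_2^d)$.
   Context: $R_{2m}(n)$ denotes the smallest redundancy $n - \dim C$ of a linear binary code $C \subseteq \mathbb{F}_2^n$ (a subspace) of length $n$ which contains no word of Hamming weight $2m$. For a nonnegative integer $d$, $\mathsf{s}_{2m}(\mathbb{Z}_2^d)$ denotes the smallest integer $s$ such that every sequence (repetitions allowed) of length $s$ of elements of $\mathbb{Z}_2^d$ has a subsequence of length $2m$ whose elements sum to $0$ (here $\mathbb{Z}_2^0$ is the trivial group). -}

module Defs where

open import Data.Nat using (ℕ; zero; suc; _+_; _*_; _<_)
open import Data.Bool using (Bool; true; false; _xor_; if_then_else_)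
open import Data.Vec using (Vec; []; _∷_; replicate; zipWith)
open import Data.Fin using (Fin)
import Data.Fin as F
open import Data.Fin.Subset using (Subset; ∣_∣)
open import Data.Product using (Σ; _×_; ∃-syntax)
open import Relation.Binary.PropositionalEquality using (_≡_; _≢_)
open import Relation.Nullary using (¬_)

-- Elements of 𝔽₂ⁿ (equivalently the group ℤ₂ⁿ) are Boolean vectors; addition is xor.
Word : ℕ → Set
Word n = Vec Bool n

𝟎 : ∀ {n} → Word n
𝟎 = replicate _ false

_⊕_ : ∀ {n} → Word n → Word n → Word n
_⊕_ = zipWith _xor_

-- Sum of the elements f i for i in the selection S (a subset of the index set Fin s).
-- Used both for subsequence sums and for 𝔽₂-linear combinations (coefficients S).
sumSel : ∀ {d} (s : ℕ) → Subset s → (Fin s → Word d) → Word d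
sumSel zero [] f = 𝟎
sumSel (suc s) (b ∷ S) f = (if b then f F.zero else 𝟎) ⊕ sumSel s S (λ i → f (F.suc i))

weight : ∀ {n} → Word n → ℕ
weight [] = 0
weight (true ∷ w) = suc (weight w)
weight (false ∷ w) = weight w

LinIndep : ∀ {n} (k : ℕ) → (Fin k → Word n) → Set
LinIndep k G = ∀ (c : Subset k) → sumSel k c G ≡ 𝟎 → c ≡ replicate k false

-- There is a linear code C ⊆ 𝔽₂ⁿ with redundancy r (i.e. dim C = k, k + r = n),
-- given by a basis G, containing no word of weight 2m.
HasCode : (m n r : ℕ) → Set
HasCode m n r =
  ∃[ k ] (k + r ≡ n) × (∃[ G ] (LinIndep {n} k G × (∀ (c : Subset k) → weight (sumSel k c G) ≢ 2 * m)))

IsR : (m n d : ℕ) → Set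
IsR m n d = HasCode m n d × (∀ r → r < d → ¬ HasCode m n r)

ZeroSum : (m d s : ℕ) → Set
ZeroSum m d s = ∀ (f : Fin s → Word d) → ∃[ S ] (∣ S ∣ ≡ 2 * m × sumSel s S f ≡ 𝟎)

IsS : (m d s : ℕ) → Set
IsS m d s = ZeroSum m d s × (∀ t → t < s → ¬ ZeroSum m d t)

-- A sequence f of n vectors in 𝔽₂^r is the list of columns of the linear map
-- ⟦ f ⟧ : 𝔽₂ⁿ → 𝔽₂^r, x ↦ Σ_{i∈x} f i, and a weight-2m word in its kernel is
-- exactly a zero-sum subsequence of f of length 2m.
-- Thus for r ≤ n a code of redundancy r avoiding weight 2m exists iff
-- ZeroSum m r n fails (decidability turns the negations around).  ZeroSum m d n
-- is monotone in n and antitone in d, so s ≤ n ⇔ ZeroSum m (d-1) n and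
-- n < s′ ⇔ ¬ ZeroSum m d n (threshold), while IsR m n d is equivalent to the
-- conjunction of the two (IsR⇔); the theorem follows.
module Submission where

open import Defs
open import Data.Nat
  using (ℕ; zero; suc; _+_; _*_; _∸_; _≤_; _<_; _≤′_; ≤′-refl; ≤′-step; z≤n; s≤s; s≤s⁻¹)
import Data.Nat as ℕ
open import Data.Nat.Properties
  using (suc-injective; +-suc; +-identityʳ; m≤n+m; m+n∸n≡m; m∸n+n≡m; ∸-monoʳ-≤; m≤n⇒m≤1+n;
         ≤-trans; ≤-reflexive; n≤1+n; ≤⇒≤′; ≰⇒>; ≮⇒≥; <⇒≱; n<1+n)
open import Data.Bool using (Bool; true; false; _xor_; _∧_; not; if_then_else_)
open import Data.Bool.Properties using (xor-comm; xor-assoc; xor-same; xor-identityˡ; xor-identityʳ)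
  renaming (_≟_ to _≟ᵇ_)
open import Data.Vec using (Vec; []; _∷_; replicate; head; tail; insertAt; lookup; tabulate)
open import Data.Vec.Properties
  using (∷-injectiveˡ; ∷-injectiveʳ; ≡-dec; lookup∘tabulate; zipWith-comm; zipWith-assoc;
         zipWith-identityˡ; zipWith-identityʳ)
open import Data.Vec.Functional using () renaming (_∷_ to _∷ᶠ_)
open import Data.Fin using (Fin; punchIn)
import Data.Fin as F
open import Data.Fin.Properties using (any?)
open import Data.Fin.Subset using (Subset; ∣_∣)
open import Data.Fin.Subset.Properties using (anySubset?; ∣⊥∣≡0)
open import Data.Product using (Σ; _×_; ∃; ∃-syntax; _,_; proj₁; proj₂)
open import Data.Sum using (_⊎_; inj₁; inj₂)
open import Data.Empty using (⊥-elim)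
open import Function using (_∘_)
open import Function.Bundles using (_⇔_; mk⇔; Equivalence)
open import Relation.Binary.PropositionalEquality
open import Relation.Nullary using (¬_; Dec; yes; no; ¬?)
open import Relation.Nullary.Decidable using (_×-dec_)

⊕-identityˡ : ∀ {n} (x : Word n) → 𝟎 ⊕ x ≡ x
⊕-identityˡ = zipWith-identityˡ xor-identityˡ

⊕-identityʳ : ∀ {n} (x : Word n) → x ⊕ 𝟎 ≡ x
⊕-identityʳ = zipWith-identityʳ xor-identityʳ

⊕-comm : ∀ {n} (x y : Word n) → x ⊕ y ≡ y ⊕ x
⊕-comm = zipWith-comm xor-comm

⊕-assoc : ∀ {n} (x y z : Word n) → (x ⊕ y) ⊕ z ≡ x ⊕ (y ⊕ z)
⊕-assoc = zipWith-assoc xor-assoc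

⊕-self : ∀ {n} (x : Word n) → x ⊕ x ≡ 𝟎
⊕-self [] = refl
⊕-self (b ∷ x) = cong₂ _∷_ (xor-same b) (⊕-self x)

⊕-cancelˡ : ∀ {n} (y x : Word n) → y ⊕ (y ⊕ x) ≡ x
⊕-cancelˡ y x = trans (sym (⊕-assoc y y x)) (trans (cong (_⊕ x) (⊕-self y)) (⊕-identityˡ x))

⊕≡𝟎⇒≡ : ∀ {n} (x y : Word n) → x ⊕ y ≡ 𝟎 → x ≡ y
⊕≡𝟎⇒≡ x y x⊕y≡𝟎 = begin
    x            ≡⟨ sym (⊕-identityʳ x) ⟩
    x ⊕ 𝟎        ≡⟨ cong (x ⊕_) (sym (⊕-self y)) ⟩
    x ⊕ (y ⊕ y)  ≡⟨ sym (⊕-assoc x y y) ⟩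
    (x ⊕ y) ⊕ y  ≡⟨ cong (_⊕ y) x⊕y≡𝟎 ⟩
    𝟎 ⊕ y        ≡⟨ ⊕-identityˡ y ⟩
    y            ∎
  where open ≡-Reasoning

⊕-leftComm : ∀ {n} (a b c : Word n) → a ⊕ (b ⊕ c) ≡ b ⊕ (a ⊕ c)
⊕-leftComm a b c = trans (sym (⊕-assoc a b c)) (trans (cong (_⊕ c) (⊕-comm a b)) (⊕-assoc b a c))

⊕-interchange : ∀ {n} (a b c d : Word n) → (a ⊕ b) ⊕ (c ⊕ d) ≡ (a ⊕ c) ⊕ (b ⊕ d)
⊕-interchange a b c d = begin
    (a ⊕ b) ⊕ (c ⊕ d)  ≡⟨ ⊕-assoc a b (c ⊕ d) ⟩
    a ⊕ (b ⊕ (c ⊕ d))  ≡⟨ cong (a ⊕_) (sym (⊕-assoc b c d)) ⟩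
    a ⊕ ((b ⊕ c) ⊕ d)  ≡⟨ cong (λ t → a ⊕ (t ⊕ d)) (⊕-comm b c) ⟩
    a ⊕ ((c ⊕ b) ⊕ d)  ≡⟨ cong (a ⊕_) (⊕-assoc c b d) ⟩
    a ⊕ (c ⊕ (b ⊕ d))  ≡⟨ sym (⊕-assoc a c (b ⊕ d)) ⟩
    (a ⊕ c) ⊕ (b ⊕ d)  ∎
  where open ≡-Reasoning

_≟ʷ_ : ∀ {n} (x y : Word n) → Dec (x ≡ y)
_≟ʷ_ = ≡-dec _≟ᵇ_

infixr 25 _·_
_·_ : ∀ {n} → Bool → Word n → Word n
b · v = if b then v else 𝟎

·-distrib-xor : ∀ {n} a b (v : Word n) → (a xor b) · v ≡ a · v ⊕ b · v
·-distrib-xor true true v = sym (⊕-self v)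
·-distrib-xor true false v = sym (⊕-identityʳ v)
·-distrib-xor false b v = sym (⊕-identityˡ _)

·-distrib-⊕ : ∀ {n} b (x y : Word n) → b · (x ⊕ y) ≡ b · x ⊕ b · y
·-distrib-⊕ true x y = refl
·-distrib-⊕ false x y = sym (⊕-identityˡ 𝟎)

·-∧ : ∀ {n} a b (v : Word n) → a · b · v ≡ (a ∧ b) · v
·-∧ true b v = refl
·-∧ false b v = refl

Word0-trivial : (w : Word 0) → w ≡ 𝟎
Word0-trivial [] = refl

weight≡∣∣ : ∀ {n} (w : Word n) → weight w ≡ ∣ w ∣
weight≡∣∣ [] = refl
weight≡∣∣ (true ∷ w) = cong suc (weight≡∣∣ w)
weight≡∣∣ (false ∷ w) = weight≡∣∣ w

⟦_⟧ : ∀ {n r} → (Fin n → Word r) → Word n → Word r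
⟦_⟧ {n} f x = sumSel n x f

sumSel-cong : ∀ {d} s (S : Subset s) (f g : Fin s → Word d) → (∀ i → f i ≡ g i) →
  sumSel s S f ≡ sumSel s S g
sumSel-cong zero [] f g f≗g = refl
sumSel-cong (suc s) (b ∷ S) f g f≗g =
  cong₂ (λ u w → b · u ⊕ w) (f≗g F.zero) (sumSel-cong s S _ _ (f≗g ∘ F.suc))

sumSel-⊥ : ∀ {d} s (f : Fin s → Word d) → sumSel s (replicate s false) f ≡ 𝟎
sumSel-⊥ zero f = refl
sumSel-⊥ (suc s) f = trans (⊕-identityˡ _) (sumSel-⊥ s _)

sumSel-𝟎 : ∀ {d} s (S : Subset s) → sumSel {d} s S (λ _ → 𝟎) ≡ 𝟎
sumSel-𝟎 zero [] = refl
sumSel-𝟎 (suc s) (true ∷ S) = trans (⊕-identityˡ _) (sumSel-𝟎 s S)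
sumSel-𝟎 (suc s) (false ∷ S) = trans (⊕-identityˡ _) (sumSel-𝟎 s S)

sumSel-⊕ˢ : ∀ {d} s (S T : Subset s) (f : Fin s → Word d) →
  sumSel s (S ⊕ T) f ≡ sumSel s S f ⊕ sumSel s T f
sumSel-⊕ˢ zero [] [] f = sym (⊕-identityˡ _)
sumSel-⊕ˢ (suc s) (a ∷ S) (b ∷ T) f =
  trans (cong₂ _⊕_ (·-distrib-xor a b _) (sumSel-⊕ˢ s S T _)) (⊕-interchange _ _ _ _)

sumSel-⊕ᶠ : ∀ {d} s (S : Subset s) (f g : Fin s → Word d) →
  sumSel s S (λ i → f i ⊕ g i) ≡ sumSel s S f ⊕ sumSel s S g
sumSel-⊕ᶠ zero [] f g = sym (⊕-identityˡ _)
sumSel-⊕ᶠ (suc s) (b ∷ S) f g =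
  trans (cong₂ _⊕_ (·-distrib-⊕ b _ _) (sumSel-⊕ᶠ s S _ _)) (⊕-interchange _ _ _ _)

sumSel-·ˢ : ∀ {d n} b (x : Word n) (f : Fin n → Word d) → sumSel n (b · x) f ≡ b · sumSel n x f
sumSel-·ˢ true x f = refl
sumSel-·ˢ false x f = sumSel-⊥ _ f

dot : ∀ s → Subset s → (Fin s → Bool) → Bool
dot zero [] h = false
dot (suc s) (b ∷ S) h = (b ∧ h F.zero) xor dot s S (h ∘ F.suc)

sumSel-multiples : ∀ {n} s (S : Subset s) (h : Fin s → Bool) (v : Word n) →
  sumSel s S (λ i → h i · v) ≡ dot s S h · v
sumSel-multiples zero [] h v = refl
sumSel-multiples (suc s) (b ∷ S) h v =
  trans (cong₂ _⊕_ (·-∧ b (h F.zero) v) (sumSel-multiples s S _ v))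
        (sym (·-distrib-xor (b ∧ h F.zero) _ v))

sumSel-compose : ∀ {d n} k (c : Subset k) (G : Fin k → Word n) (f : Fin n → Word d) →
  ⟦ f ⟧ (sumSel k c G) ≡ sumSel k c (⟦ f ⟧ ∘ G)
sumSel-compose zero [] G f = sumSel-⊥ _ f
sumSel-compose {n = n} (suc k) (b ∷ c) G f =
  trans (sumSel-⊕ˢ n _ _ f) (cong₂ _⊕_ (sumSel-·ˢ b _ f) (sumSel-compose k c _ f))

kernel-closed : ∀ {d n} k (G : Fin k → Word n) (f : Fin n → Word d) →
  (∀ i → ⟦ f ⟧ (G i) ≡ 𝟎) → ∀ c → ⟦ f ⟧ (sumSel k c G) ≡ 𝟎
kernel-closed k G f ker c =
  trans (sumSel-compose k c G f) (trans (sumSel-cong k c _ _ ker) (sumSel-𝟎 k c))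

sumSel-false∷ : ∀ {d} s (S : Subset s) (f : Fin s → Word d) →
  sumSel s S (λ i → false ∷ f i) ≡ false ∷ sumSel s S f
sumSel-false∷ zero [] f = refl
sumSel-false∷ (suc s) (true ∷ S) f = cong ((false ∷ f F.zero) ⊕_) (sumSel-false∷ s S _)
sumSel-false∷ (suc s) (false ∷ S) f = cong (𝟎 ⊕_) (sumSel-false∷ s S _)

withUnit : ∀ {n r} → (Fin n → Word r) → Fin (suc n) → Word (suc r)
withUnit f = (true ∷ 𝟎) ∷ᶠ (λ i → false ∷ f i)

sumSel-withUnit : ∀ {n r} b (x : Word n) (f : Fin n → Word r) →
  ⟦ withUnit f ⟧ (b ∷ x) ≡ b ∷ ⟦ f ⟧ x
sumSel-withUnit {n} b x f = trans (cong (b · (true ∷ 𝟎) ⊕_) (sumSel-false∷ n x f)) (unit b)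
  where
    unit : ∀ b → b · (true ∷ 𝟎) ⊕ (false ∷ ⟦ f ⟧ x) ≡ b ∷ ⟦ f ⟧ x
    unit true = cong (true ∷_) (⊕-identityˡ _)
    unit false = cong (false ∷_) (⊕-identityˡ _)

sumSel-insertAt : ∀ {n} k (c : Subset k) (j : Fin (suc k)) b (G : Fin (suc k) → Word n) →
  sumSel (suc k) (insertAt c j b) G ≡ b · G j ⊕ sumSel k c (G ∘ punchIn j)
sumSel-insertAt k c F.zero b G = refl
sumSel-insertAt (suc k) (a ∷ c) (F.suc j) b G =
  trans (cong (a · G F.zero ⊕_) (sumSel-insertAt k c j b (G ∘ F.suc))) (⊕-leftComm _ _ _)

sumSel-insertAt-not : ∀ {n} k (c : Subset k) (j : Fin (suc k)) b (G : Fin (suc k) → Word n) →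
  sumSel (suc k) (insertAt c j (not b)) G ≡ G j ⊕ sumSel (suc k) (insertAt c j b) G
sumSel-insertAt-not k c j b G = begin
    sumSel (suc k) (insertAt c j (not b)) G  ≡⟨ sumSel-insertAt k c j (not b) G ⟩
    not b · G j ⊕ R                          ≡⟨ cong (_⊕ R) (·-distrib-xor true b (G j)) ⟩
    (G j ⊕ b · G j) ⊕ R                      ≡⟨ ⊕-assoc (G j) _ R ⟩
    G j ⊕ (b · G j ⊕ R)                      ≡⟨ cong (G j ⊕_) (sym (sumSel-insertAt k c j b G)) ⟩
    G j ⊕ sumSel (suc k) (insertAt c j b) G  ∎
  where
    open ≡-Reasoning
    R = sumSel k c (G ∘ punchIn j)

insertAt-⊥ : ∀ k (c : Subset k) j b → insertAt c j b ≡ replicate (suc k) false → c ≡ replicate k false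
insertAt-⊥ k c F.zero b eq = ∷-injectiveʳ eq
insertAt-⊥ (suc k) (a ∷ c) (F.suc j) b eq =
  cong₂ _∷_ (∷-injectiveˡ eq) (insertAt-⊥ k c j b (∷-injectiveʳ eq))

LinIndep-cong : ∀ {n} k {G H : Fin k → Word n} → (∀ i → G i ≡ H i) → LinIndep k G → LinIndep k H
LinIndep-cong k G≗H ind c z = ind c (trans (sumSel-cong k c _ _ G≗H) z)

false∷-indep : ∀ {n} k (G : Fin k → Word n) → LinIndep k G → LinIndep k (λ i → false ∷ G i)
false∷-indep k G ind c z = ind c (∷-injectiveʳ (trans (sym (sumSel-false∷ k c G)) z))

indep-false∷ : ∀ {n} k (G : Fin k → Word n) → LinIndep k (λ i → false ∷ G i) → LinIndep k G
indep-false∷ k G ind c z = ind c (trans (sumSel-false∷ k c G) (cong (false ∷_) z))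

adjoin-indep : ∀ {n} k (v : Word n) (G : Fin k → Word n) →
  (∀ c → sumSel k c G ≢ v) → LinIndep k G → LinIndep (suc k) (v ∷ᶠ G)
adjoin-indep k v G v∉span ind (true ∷ c) z = ⊥-elim (v∉span c (sym (⊕≡𝟎⇒≡ v _ z)))
adjoin-indep k v G v∉span ind (false ∷ c) z = cong (false ∷_) (ind c (trans (sym (⊕-identityˡ _)) z))

drop-indep : ∀ {n} k (G : Fin (suc k) → Word n) → LinIndep (suc k) G → LinIndep k (G ∘ F.suc)
drop-indep k G ind c z = ∷-injectiveʳ (ind (false ∷ c) (trans (⊕-identityˡ _) z))

subfamily : ∀ {n a k} → a ≤′ k → (G : Fin k → Word n) → LinIndep k G →
  Σ (Fin a → Word n) λ H → LinIndep a H × (∀ i → ∃ λ j → H i ≡ G j)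
subfamily ≤′-refl G ind = G , ind , λ i → i , refl
subfamily {k = suc k} (≤′-step a≤k) G ind with subfamily a≤k (G ∘ F.suc) (drop-indep k G ind)
... | H , indH , H⊆G = H , indH , λ i → F.suc (proj₁ (H⊆G i)) , proj₂ (H⊆G i)

pivot? : ∀ {n k} (G : Fin k → Word (suc n)) →
  (∃ λ j → head (G j) ≡ true) ⊎ (∀ j → G j ≡ false ∷ tail (G j))
pivot? G with any? (λ j → head (G j) ≟ᵇ true)
... | yes pivot = inj₁ pivot
... | no noPivot = inj₂ (λ j → headFalse (G j) (λ h → noPivot (j , h)))
  where
    headFalse : ∀ {n} (x : Word (suc n)) → head x ≢ true → x ≡ false ∷ tail x
    headFalse (true ∷ x) h = ⊥-elim (h refl)
    headFalse (false ∷ x) h = refl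

reduce : ∀ {n k} (G : Fin (suc k) → Word (suc n)) (j : Fin (suc k)) → Fin k → Word n
reduce G j i = tail (G (punchIn j i) ⊕ head (G (punchIn j i)) · G j)

-- The coefficients, with respect to G, of the combination c of the reduced vectors.
lift : ∀ {n k} (G : Fin (suc k) → Word (suc n)) (j : Fin (suc k)) → Subset k → Subset (suc k)
lift {k = k} G j c = insertAt c j (dot k c (λ i → head (G (punchIn j i))))

sumSel-reduce : ∀ {n k} (G : Fin (suc k) → Word (suc n)) (j : Fin (suc k)) → head (G j) ≡ true →
  ∀ c → sumSel (suc k) (lift G j c) G ≡ false ∷ sumSel k c (reduce G j)
sumSel-reduce {k = k} G j pivot c = begin
    sumSel (suc k) (lift G j c) G        ≡⟨ sumSel-insertAt k c j β G ⟩
    β · G j ⊕ R                          ≡⟨ ⊕-comm (β · G j) R ⟩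
    R ⊕ β · G j                          ≡⟨ cong (R ⊕_) (sym (sumSel-multiples k c h (G j))) ⟩
    R ⊕ sumSel k c (λ i → h i · G j)     ≡⟨ sym (sumSel-⊕ᶠ k c _ _) ⟩
    sumSel k c (λ i → G′ i ⊕ h i · G j)  ≡⟨ sumSel-cong k c _ _ (λ i → cleared (G′ i) (G j) pivot) ⟩
    sumSel k c (λ i → false ∷ reduce G j i)
                                         ≡⟨ sumSel-false∷ k c (reduce G j) ⟩
    false ∷ sumSel k c (reduce G j)      ∎
  where
    open ≡-Reasoning
    G′ = G ∘ punchIn j
    h = head ∘ G′
    β = dot k c h
    R = sumSel k c G′
    cleared : ∀ {n} (x y : Word (suc n)) → head y ≡ true → x ⊕ head x · y ≡ false ∷ tail (x ⊕ head x · y)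
    cleared (true ∷ x) (true ∷ y) refl = refl
    cleared (false ∷ x) (true ∷ y) refl = refl

reduce-indep : ∀ {n k} (G : Fin (suc k) → Word (suc n)) (j : Fin (suc k)) → head (G j) ≡ true →
  LinIndep (suc k) G → LinIndep k (reduce G j)
reduce-indep {k = k} G j pivot ind c z =
  insertAt-⊥ k c j _ (ind (lift G j c) (trans (sumSel-reduce G j pivot c) (cong (false ∷_) z)))

tail-indep : ∀ {n} k (G : Fin k → Word (suc n)) → (∀ j → G j ≡ false ∷ tail (G j)) →
  LinIndep k G → LinIndep k (tail ∘ G)
tail-indep k G noPivot = indep-false∷ k (tail ∘ G) ∘ LinIndep-cong k noPivot

indep⇒≤ : ∀ {r} k (G : Fin k → Word r) → LinIndep k G → k ≤ r
indep⇒≤ zero G ind = z≤n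
indep⇒≤ {zero} (suc k) G ind with ind (true ∷ replicate k false) (Word0-trivial _)
... | ()
indep⇒≤ {suc r} (suc k) G ind with pivot? G
... | inj₁ (j , pivot) = s≤s (indep⇒≤ k (reduce G j) (reduce-indep G j pivot ind))
... | inj₂ noPivot = m≤n⇒m≤1+n (indep⇒≤ (suc k) (tail ∘ G) (tail-indep (suc k) G noPivot ind))

ParityCheck : ∀ n k r → (Fin k → Word n) → Set
ParityCheck n k r G = Σ (Fin n → Word r) λ H → ∀ x → ⟦ H ⟧ x ≡ 𝟎 → ∃ λ c → sumSel k c G ≡ x

-- Pivot step: a parity check H′ for the reduced family extends to G by giving
-- the pivot coordinate the column ⟦ H′ ⟧ (tail (G j)), which makes G j a codeword.
parityCheck-pivot : ∀ {n k r} (G : Fin (suc k) → Word (suc n)) (j : Fin (suc k)) → head (G j) ≡ true →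
  ParityCheck n k r (reduce G j) → ParityCheck (suc n) (suc k) r G
parityCheck-pivot {n} {k} G j pivot (H′ , kerH′⊆span) = ⟦ H′ ⟧ g ∷ᶠ H′ , kerH⊆span
  where
    g = tail (G j)
    kerH⊆span : ∀ x → ⟦ ⟦ H′ ⟧ g ∷ᶠ H′ ⟧ x ≡ 𝟎 → ∃ λ c → sumSel (suc k) c G ≡ x
    kerH⊆span (false ∷ x) z with kerH′⊆span x (trans (sym (⊕-identityˡ _)) z)
    ... | c , eq = lift G j c , trans (sumSel-reduce G j pivot c) (cong (false ∷_) eq)
    kerH⊆span (true ∷ x) z with kerH′⊆span (g ⊕ x) (trans (sumSel-⊕ˢ n g x H′) z)
    ... | c , eq = insertAt c j (not _) , (begin
        sumSel (suc k) (insertAt c j (not _)) G  ≡⟨ sumSel-insertAt-not k c j _ G ⟩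
        G j ⊕ sumSel (suc k) (lift G j c) G      ≡⟨ cong (G j ⊕_) (sumSel-reduce G j pivot c) ⟩
        G j ⊕ (false ∷ sumSel k c (reduce G j))  ≡⟨ cong₂ (λ u w → u ⊕ (false ∷ w)) (headTrue (G j) pivot) eq ⟩
        (true ∷ g) ⊕ (false ∷ (g ⊕ x))           ≡⟨ cong (true ∷_) (⊕-cancelˡ g x) ⟩
        true ∷ x                                 ∎)
      where
        open ≡-Reasoning
        headTrue : ∀ {n} (y : Word (suc n)) → head y ≡ true → y ≡ true ∷ tail y
        headTrue (true ∷ y) refl = refl

-- No-pivot step: G lies in the hyperplane x₀ = 0, so a parity check for the
-- tails plus one new row testing x₀ is a parity check for G.
parityCheck-noPivot : ∀ {n k r} (G : Fin k → Word (suc n)) → (∀ j → G j ≡ false ∷ tail (G j)) →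
  ParityCheck n k r (tail ∘ G) → ParityCheck (suc n) k (suc r) G
parityCheck-noPivot {k = k} G noPivot (H′ , kerH′⊆span) = withUnit H′ , kerH⊆span
  where
    kerH⊆span : ∀ x → ⟦ withUnit H′ ⟧ x ≡ 𝟎 → ∃ λ c → sumSel k c G ≡ x
    kerH⊆span (b ∷ x) z with ∷-injectiveˡ (trans (sym (sumSel-withUnit b x H′)) z)
                           | kerH′⊆span x (∷-injectiveʳ (trans (sym (sumSel-withUnit b x H′)) z))
    ... | refl | c , eq =
      c , trans (sumSel-cong k c _ _ noPivot) (trans (sumSel-false∷ k c _) (cong (false ∷_) eq))

-- Without a pivot and with r = 0 the
-- k = n + 1 tails would be independent in 𝔽₂ⁿ, which is impossible.
parityCheck : ∀ n k r → k + r ≡ n → (G : Fin k → Word n) → LinIndep k G → ParityCheck n k r G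
parityCheck zero zero zero refl G ind = (λ ()) , λ { [] _ → [] , refl }
parityCheck (suc n) k r k+r≡n G ind with pivot? G
parityCheck (suc n) (suc k) r k+r≡n G ind | inj₁ (j , pivot) =
  parityCheck-pivot G j pivot
    (parityCheck n k r (suc-injective k+r≡n) (reduce G j) (reduce-indep G j pivot ind))
parityCheck (suc n) k zero k+0≡1+n G ind | inj₂ noPivot =
  ⊥-elim (<⇒≱ (n<1+n n) (≤-trans (≤-reflexive (sym k≡1+n))
                                   (indep⇒≤ k (tail ∘ G) (tail-indep k G noPivot ind))))
  where
    k≡1+n : k ≡ suc n
    k≡1+n = trans (sym (+-identityʳ k)) k+0≡1+n
parityCheck (suc n) k (suc r) k+r≡n G ind | inj₂ noPivot =
  parityCheck-noPivot G noPivot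
    (parityCheck n k r (suc-injective (trans (sym (+-suc k r)) k+r≡n)) (tail ∘ G) (tail-indep k G noPivot ind))

-- Rank–nullity for ⟦ f ⟧ : 𝔽₂ⁿ → 𝔽₂^r: independent kernel vectors and
-- vectors with independent images, k + ρ = n of them in total.
record KernelSplit (n r : ℕ) (f : Fin n → Word r) : Set where
  field
    k ρ : ℕ
    k+ρ≡n : k + ρ ≡ n
    kernel : Fin k → Word n
    kernel-indep : LinIndep k kernel
    kernel-zero : ∀ i → ⟦ f ⟧ (kernel i) ≡ 𝟎
    complement : Fin ρ → Word n
    image-indep : LinIndep ρ (⟦ f ⟧ ∘ complement)

-- If the first column is the combination y of the others, (1, y) is a new kernel vector.
kernelSplit-dependent : ∀ {n r} (f : Fin (suc n) → Word r) (y : Word n) → ⟦ f ∘ F.suc ⟧ y ≡ f F.zero →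
  KernelSplit n r (f ∘ F.suc) → KernelSplit (suc n) r f
kernelSplit-dependent f y y↦f₀ split = record
  { k = suc k ; ρ = ρ ; k+ρ≡n = cong suc k+ρ≡n
  ; kernel = (true ∷ y) ∷ᶠ (λ i → false ∷ kernel i)
  ; kernel-indep = adjoin-indep k _ _ (λ c eq → headMismatch (trans (sym (sumSel-false∷ k c kernel)) eq))
                                (false∷-indep k kernel kernel-indep)
  ; kernel-zero = λ { F.zero → trans (cong (f F.zero ⊕_) y↦f₀) (⊕-self (f F.zero))
                    ; (F.suc i) → trans (⊕-identityˡ _) (kernel-zero i) }
  ; complement = λ i → false ∷ complement i
  ; image-indep = LinIndep-cong ρ (λ i → sym (⊕-identityˡ _)) image-indep }
  where
    open KernelSplit split
    headMismatch : ∀ {w} → false ∷ w ≢ true ∷ y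
    headMismatch ()

-- Otherwise the first unit vector joins the complement: its image f₀ lies
-- outside the span of the other images.
kernelSplit-independent : ∀ {n r} (f : Fin (suc n) → Word r) →
  ¬ (∃ λ y → ⟦ f ∘ F.suc ⟧ y ≡ f F.zero) → KernelSplit n r (f ∘ F.suc) → KernelSplit (suc n) r f
kernelSplit-independent {n} f f₀∉span split = record
  { k = k ; ρ = suc ρ ; k+ρ≡n = trans (+-suc k ρ) (cong suc k+ρ≡n)
  ; kernel = λ i → false ∷ kernel i
  ; kernel-indep = false∷-indep k kernel kernel-indep
  ; kernel-zero = λ i → trans (⊕-identityˡ _) (kernel-zero i)
  ; complement = withUnit complement
  ; image-indep = LinIndep-cong (suc ρ) images
      (adjoin-indep ρ (f F.zero) (⟦ f ∘ F.suc ⟧ ∘ complement)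
        (λ c eq → f₀∉span (sumSel ρ c complement , trans (sumSel-compose ρ c complement _) eq))
        image-indep) }
  where
    open KernelSplit split
    images : ∀ i → (f F.zero ∷ᶠ (⟦ f ∘ F.suc ⟧ ∘ complement)) i ≡ ⟦ f ⟧ (withUnit complement i)
    images F.zero = sym (trans (cong (f F.zero ⊕_) (sumSel-⊥ n _)) (⊕-identityʳ _))
    images (F.suc i) = sym (⊕-identityˡ _)

kernelSplit : ∀ n r (f : Fin n → Word r) → KernelSplit n r f
kernelSplit zero r f = record
  { k = 0 ; ρ = 0 ; k+ρ≡n = refl
  ; kernel = λ () ; kernel-indep = λ { [] _ → refl } ; kernel-zero = λ ()
  ; complement = λ () ; image-indep = λ { [] _ → refl } }
kernelSplit (suc n) r f with anySubset? (λ y → ⟦ f ∘ F.suc ⟧ y ≟ʷ f F.zero)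
... | yes (y , y↦f₀) = kernelSplit-dependent f y y↦f₀ (kernelSplit n r (f ∘ F.suc))
... | no f₀∉span = kernelSplit-independent f f₀∉span (kernelSplit n r (f ∘ F.suc))

HasZeroSum : (m n d : ℕ) → (Fin n → Word d) → Set
HasZeroSum m n d f = ∃[ S ] (∣ S ∣ ≡ 2 * m × sumSel n S f ≡ 𝟎)

hasZeroSum? : ∀ m n d (f : Fin n → Word d) → Dec (HasZeroSum m n d f)
hasZeroSum? m n d f = anySubset? (λ S → (∣ S ∣ ℕ.≟ 2 * m) ×-dec (sumSel n S f ≟ʷ 𝟎))

redundancy≤length : ∀ {m n r} → HasCode m n r → r ≤ n
redundancy≤length {r = r} (k , k+r≡n , _) = ≤-trans (m≤n+m r k) (≤-reflexive k+r≡n)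

zeroCode : ∀ m n → 1 ≤ m → HasCode m n n
zeroCode (suc m) n _ = 0 , refl , (λ ()) , (λ { [] _ → refl }) ,
  λ { [] w → 0≢2m (trans (sym (trans (weight≡∣∣ (𝟎 {n})) (∣⊥∣≡0 n))) w) }
  where
    0≢2m : 0 ≢ 2 * suc m
    0≢2m ()

-- A code of redundancy r without weight 2m refutes ZeroSum m r n: a zero-sum
-- subsequence of length 2m of its parity-check columns would be a codeword of weight 2m.
code⇒¬ZeroSum : ∀ {m n r} → HasCode m n r → ¬ ZeroSum m r n
code⇒¬ZeroSum {n = n} {r} (k , k+r≡n , G , ind , noWeight2m) zeroSum
  with parityCheck n k r k+r≡n G ind
... | H , kerH⊆C with zeroSum H
... | S , ∣S∣≡2m , HS≡𝟎 with kerH⊆C S HS≡𝟎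
... | c , GcS = noWeight2m c (trans (cong weight GcS) (trans (weight≡∣∣ S) ∣S∣≡2m))

-- Conversely, n - r independent kernel vectors of a zero-sum-free sequence
-- span a code of redundancy r without weight 2m.
free⇒code : ∀ {m n r} → r ≤ n → (f : Fin n → Word r) → ¬ HasZeroSum m n r f → HasCode m n r
free⇒code {m} {n} {r} r≤n f free =
  n ∸ r , m∸n+n≡m r≤n , C , proj₁ (proj₂ sub) , noWeight2m
  where
    open KernelSplit (kernelSplit n r f)
    n∸r≤k : n ∸ r ≤ k
    n∸r≤k = ≤-trans (∸-monoʳ-≤ n (indep⇒≤ ρ _ image-indep))
                    (≤-reflexive (trans (cong (_∸ ρ) (sym k+ρ≡n)) (m+n∸n≡m k ρ)))
    sub = subfamily (≤⇒≤′ n∸r≤k) kernel kernel-indep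
    C = proj₁ sub
    C-zero : ∀ i → ⟦ f ⟧ (C i) ≡ 𝟎
    C-zero i with proj₂ (proj₂ sub) i
    ... | j , Ci≡kj = trans (cong ⟦ f ⟧ Ci≡kj) (kernel-zero j)
    noWeight2m : ∀ c → weight (sumSel (n ∸ r) c C) ≢ 2 * m
    noWeight2m c w = free (word , trans (sym (weight≡∣∣ word)) w , kernel-closed (n ∸ r) C f C-zero c)
      where word = sumSel (n ∸ r) c C

-- Classical step, justified by decidability: if no code of redundancy r ≤ n
-- avoids weight 2m, every sequence has a zero-sum subsequence of length 2m.
¬code⇒ZeroSum : ∀ {m n r} → r ≤ n → ¬ HasCode m n r → ZeroSum m r n
¬code⇒ZeroSum {m} {n} {r} r≤n noCode f with hasZeroSum? m n r f
... | yes zeroSum = zeroSum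
... | no free = ⊥-elim (noCode (free⇒code {m} r≤n f free))

-- Longer sequences: ignore the first term.
ZeroSum-length-mono : ∀ {m d s t} → s ≤′ t → ZeroSum m d s → ZeroSum m d t
ZeroSum-length-mono ≤′-refl zeroSum = zeroSum
ZeroSum-length-mono {m} (≤′-step s≤t) zeroSum f
  with ZeroSum-length-mono {m} s≤t zeroSum (f ∘ F.suc)
... | S , ∣S∣≡2m , z = false ∷ S , ∣S∣≡2m , trans (⊕-identityˡ _) z

-- Smaller groups: embed ℤ₂^d into ℤ₂^{d+1} by a zero first coordinate.
ZeroSum-dim-mono : ∀ {m d′ d t} → d′ ≤′ d → ZeroSum m d t → ZeroSum m d′ t
ZeroSum-dim-mono ≤′-refl zeroSum = zeroSum
ZeroSum-dim-mono {m} {t = t} (≤′-step d′≤d) zeroSum = ZeroSum-dim-mono {m} d′≤d embedded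
  where
    embedded : ZeroSum m _ t
    embedded f with zeroSum (λ i → false ∷ f i)
    ... | S , ∣S∣≡2m , z = S , ∣S∣≡2m , ∷-injectiveʳ (trans (sym (sumSel-false∷ t S f)) z)

-- Zero sums are forced only for lengths beyond the dimension: by the zero code
-- ZeroSum m n n fails, hence so does ZeroSum m d n for every d ≥ n.
ZeroSum⇒dim<length : ∀ {m d n} → 1 ≤ m → ZeroSum m d n → d < n
ZeroSum⇒dim<length {m} {d} {n} 1≤m zeroSum with d ℕ.<? n
... | yes d<n = d<n
... | no d≮n =
  ⊥-elim (code⇒¬ZeroSum {m} (zeroCode m n 1≤m) (ZeroSum-dim-mono {m} (≤⇒≤′ (≮⇒≥ d≮n)) zeroSum))

Searchable : Set → Set₁
Searchable A = ∀ (P : A → Set) → (∀ x → Dec (P x)) → Dec (∃ P)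

searchable-Vec : ∀ {A} → Searchable A → ∀ n → Searchable (Vec A n)
searchable-Vec search zero P P? with P? []
... | yes p = yes ([] , p)
... | no ¬p = no λ { ([] , p) → ¬p p }
searchable-Vec search (suc n) P P?
  with search (λ x → ∃ λ v → P (x ∷ v)) (λ x → searchable-Vec search n (P ∘ (x ∷_)) (P? ∘ (x ∷_)))
... | yes (x , v , p) = yes (x ∷ v , p)
... | no ¬p = no λ { (x ∷ v , p) → ¬p (x , v , p) }

-- If some sequence of length n in ℤ₂^d has no zero-sum subsequence of
-- length 2m, one can be exhibited (the search space is finite).
¬ZeroSum⇒free : ∀ {m d n} → ¬ ZeroSum m d n → ∃ λ f → ¬ HasZeroSum m n d f
¬ZeroSum⇒free {m} {d} {n} notZeroSum
  with searchable-Vec (λ P P? → anySubset? P?) n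
         (λ v → ¬ HasZeroSum m n d (lookup v)) (λ v → ¬? (hasZeroSum? m n d (lookup v)))
... | yes (v , free) = lookup v , free
... | no noneFree = ⊥-elim (notZeroSum zeroSum)
  where
    zeroSum : ZeroSum m d n
    zeroSum f with hasZeroSum? m n d f
    ... | yes z = z
    ... | no free = ⊥-elim (noneFree (tabulate f , λ { (S , ∣S∣≡2m , z) →
            free (S , ∣S∣≡2m , trans (sumSel-cong n S f _ (sym ∘ lookup∘tabulate f)) z) }))

threshold : ∀ {m d s n} → IsS m d s → (s ≤ n ⇔ ZeroSum m d n)
threshold {m} {s = s} {n} (zeroSum , minimal) =
  mk⇔ (λ s≤n → ZeroSum-length-mono {m} (≤⇒≤′ s≤n) zeroSum) lower
  where
    lower : ZeroSum m _ n → s ≤ n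
    lower zeroSumₙ with s ℕ.≤? n
    ... | yes s≤n = s≤n
    ... | no s≰n = ⊥-elim (minimal n (≰⇒> s≰n) zeroSumₙ)

IsR⇔ : ∀ {m n d} → 1 ≤ m → IsR m n (suc d) ⇔ (ZeroSum m d n × ¬ ZeroSum m (suc d) n)
IsR⇔ {m} {n} {d} 1≤m = mk⇔ to from
  where
    to : IsR m n (suc d) → ZeroSum m d n × ¬ ZeroSum m (suc d) n
    to (code , minimal) =
      ¬code⇒ZeroSum {m} (≤-trans (n≤1+n d) (redundancy≤length {m} code)) (minimal d (n<1+n d)) ,
      code⇒¬ZeroSum {m} code
    from : ZeroSum m d n × ¬ ZeroSum m (suc d) n → IsR m n (suc d)
    from (zeroSum , notZeroSum) =
      free⇒code {m} (ZeroSum⇒dim<length 1≤m zeroSum) (proj₁ free) (proj₂ free) ,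
      λ r r<1+d code → code⇒¬ZeroSum {m} code (ZeroSum-dim-mono {m} (≤⇒≤′ (s≤s⁻¹ r<1+d)) zeroSum)
      where
        free = ¬ZeroSum⇒free {m} notZeroSum

theorem9 : ∀ (m n d : ℕ) → 1 ≤ m → 1 ≤ n → 1 ≤ d →
    ∀ (s s′ : ℕ) → IsS m (d ∸ 1) s → IsS m d s′ →
    (IsR m n d ⇔ (s ≤ n × n < s′))
theorem9 m n (suc d) 1≤m _ _ _ _ isS isS′ = mk⇔
  (λ isR → let (zeroSum , notZeroSum) = to (IsR⇔ 1≤m) isR in
     from (threshold {m} isS) zeroSum , ≰⇒> (notZeroSum ∘ to (threshold {m} isS′)))
  (λ (s≤n , n<s′) → from (IsR⇔ 1≤m)
     (to (threshold {m} isS) s≤n , λ zeroSum → <⇒≱ n<s′ (from (threshold {m} isS′) zeroSum)))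
  where open Equivalence
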